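{- Let $n$ be a positive integer. For each $\lambda\in\mathcal{G_I'}(n)$ let $\mathcal{G}_\lambda=\{\varrho_i(\lambda):1\leq i\leq m(\lambda)\}$. Then the sets $\mathcal{G}_\lambda$, $\lambda\in\mathcal{G_I'}(n)$, are pairwise disjoint and \[ \mathcal{G}(n)\setminus\mathcal{G}^0(n)=\bigcup_{\lambda\in\mathcal{G_I'}(n)}\mathcal{G}_\lambda . \]
   Context: A partition is a finite multiset of positive integers; $\bar{\ell}(\lambda)$ is its number of distinct part values and $m(\lambda)$ the multiplicity of its largest part. A partition is gap-free if its distinct part values are consecutive integers. $\mathcal{G}(n)$ is the set of gap-free partitions of $n$; $\mathcal{G}^0(n)$ is the set of partitions of $n$ with exactly one distinct part value; $\mathcal{G_I'}(n)$ is the set of gap-free partitions of $n$ with smallest part $1$ and even largest part. For a gap-free partition $\mu$ with at least $r$ distinct parts, $\xi_r(\mu)$ is obtained by taking the $r$ smallest distinct part values $v$ of $\mu$ and, for each simultaneously, replacing one copy of $v$ by $v+1$. For a gap-free partition $\lambda$ with smallest part $1$, largest part $\ell=\bar{\ell}(\lambda)$ of multiplicity $m(\lambda)$, and $1\leq i\leq m(\lambda)$: let $\lambda^i_1$ be $\lambda$ with $i-1$ copies of $\ell$ deleted, let $\lambda^i_j=\xi_\ell(\lambda^i_{j-1})$ for $2\leq j\leq i$, and set $\varrho_i(\lambda)=\lambda^i_i$ (at each step $\xi_\ell$ is applied to a gap-free partition with at least $\ell$ distinct parts, so this is defined). -}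

module Defs where

open import Data.Nat using (ℕ; zero; suc; _+_; _≤_; _<_; _⊔_; _∸_)
open import Data.Nat.Properties using (≤-decTotalOrder; _≟_)
open import Data.Nat.Divisibility using (_∣_)
open import Data.List using (List; []; _∷_; _++_; length; map; take; filter; deduplicate; foldr; head)
open import Data.Nat.ListAction using (sum)
open import Data.List.Relation.Unary.All using (All)
open import Data.List.Relation.Unary.Linked using (Linked)
open import Data.List.Sort ≤-decTotalOrder using (sort)
open import Data.Maybe using (Maybe; just)
open import Data.Product using (_×_)
open import Data.Unit using (⊤)
open import Relation.Binary.PropositionalEquality using (_≡_)
open import Relation.Nullary using (Dec; yes; no)

-- A partition is represented canonically as a NON-DECREASING list of
-- positive integers (so multiset equality = list equality).
IsPartitionOf : ℕ → List ℕ → Set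
IsPartitionOf n λ' = Linked _≤_ λ' × All (0 <_) λ' × sum λ' ≡ n

distinct : List ℕ → List ℕ
distinct = deduplicate _≟_

ℓ̄ : List ℕ → ℕ
ℓ̄ λ' = length (distinct λ')

-- largest part (0 for the empty partition)
maxPart : List ℕ → ℕ
maxPart = foldr _⊔_ 0

mult : List ℕ → ℕ
mult λ' = length (filter (_≟ maxPart λ') λ')

Consecutive : List ℕ → Set
Consecutive [] = ⊤
Consecutive (x ∷ []) = ⊤
Consecutive (x ∷ y ∷ r) = (y ≡ suc x) × Consecutive (y ∷ r)

GapFree : List ℕ → Set
GapFree λ' = Consecutive (distinct λ')

InG : ℕ → List ℕ → Set
InG n λ' = IsPartitionOf n λ' × GapFree λ'

InG0 : ℕ → List ℕ → Set
InG0 n λ' = IsPartitionOf n λ' × ℓ̄ λ' ≡ 1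

-- 𝒢_I'(n): gap-free, smallest part 1 (head of the non-decreasing list),
-- even largest part
InGI' : ℕ → List ℕ → Set
InGI' n λ' = InG n λ' × head λ' ≡ just 1 × 2 ∣ maxPart λ'

removeOne : ℕ → List ℕ → List ℕ
removeOne v [] = []
removeOne v (x ∷ xs) with x ≟ v
... | yes _ = xs
... | no _ = x ∷ removeOne v xs

iterate : {A : Set} → (A → A) → ℕ → A → A
iterate f zero a = a
iterate f (suc k) a = f (iterate f k a)

-- ξ_r(μ): for each of the r smallest distinct values v, replace one copy
-- of v by v+1 (result re-sorted into canonical non-decreasing form)
ξ : ℕ → List ℕ → List ℕ
ξ r μ = sort (map suc vs ++ foldr removeOne μ vs)
  where vs = take r (distinct μ)

ϱ : ℕ → List ℕ → List ℕ
ϱ i λ' = iterate (ξ ℓ) (i ∸ 1) (iterate (removeOne ℓ) (i ∸ 1) λ')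
  where ℓ = ℓ̄ λ'

-- Call a gap-free partition with smallest part x ≥ 1 an ℓ-window if its largest part is
-- x+ℓ−1 or x+ℓ. Its ℓ smallest distinct values are then x, …, x+ℓ−1, so ξ_ℓ merely replaces
-- one copy of x by x+ℓ: on windows ξ_ℓ is a rotation, which yields an ℓ-window again and adds
-- ℓ to the sum. For λ ∈ 𝒢_I'(n) we have ℓ̄(λ) = max λ = ℓ, which is even, and λ^i_1 is a seed,
-- i.e. a gap-free partition running from 1 to ℓ (hence an ℓ-window); so ϱ_i(λ) is the
-- (i−1)-fold rotation of λ^i_1, and λ is λ^i_1 followed by i−1 copies of ℓ.
-- Conversely, μ ∈ 𝒢(n) ∖ 𝒢⁰(n) whose largest part exceeds its smallest by w ≥ 1 is an ℓ-window
-- for the even ℓ ∈ {w, w+1}, and undoing rotations while the largest part exceeds ℓ ends at a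
-- seed. For disjointness, the parity of ℓ recovers ℓ from ϱ_i(λ), rotation is injective, and a
-- seed (largest part ℓ) is never the rotation of a window (largest part > ℓ).

module Submission where

open import Defs
open import Data.Nat.Properties
open import Data.Empty using (⊥; ⊥-elim)
open import Data.List
  using (List; []; _∷_; _++_; _∷ʳ_; [_]; length; map; take; filter; foldr; replicate)
open import Data.List.Membership.Propositional using (_∈_)
open import Data.List.Membership.Propositional.Properties using (∈-++⁻; ∈-deduplicate⁻)
open import Data.List.Properties
  using (∷-injectiveˡ; ∷ʳ-injective; ∷ʳ-injectiveʳ; ++-assoc; length-replicate;
         filter-++; filter-all; filter-none; filter-reject; filter-idem)
open import Data.List.Relation.Binary.Permutation.Propositional
  using (_↭_; ↭-refl; ↭-sym; ↭-trans; ↭⇒↭ₛ; prep; swap; module PermutationReasoning)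
open import Data.List.Relation.Binary.Permutation.Propositional.Properties
  using (drop-∷; shift; ∈-resp-↭; ++⁺ˡ; ++⁺ʳ; ∷↭∷ʳ)
open import Data.List.Relation.Binary.Pointwise using (Pointwise-≡⇒≡)
open import Data.List.Relation.Unary.All as All using (All; []; _∷_)
import Data.List.Relation.Unary.All.Properties as All
open import Data.List.Relation.Unary.Any using (here; there)
open import Data.List.Relation.Unary.Linked using (Linked; []; [-]; _∷_)
import Data.List.Relation.Unary.Linked as Linked
open import Data.List.Relation.Unary.Linked.Properties using (Linked⇒All)
import Data.List.Relation.Unary.Sorted.TotalOrder.Properties as Sorted
open import Data.List.Relation.Unary.Unique.Propositional using (Unique; []; _∷_)
open import Data.List.Relation.Unary.Unique.DecPropositional.Properties _≟_
  using (deduplicate-!; take⁺)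
open import Data.List.Sort ≤-decTotalOrder using (sort; sort-↭; sort-↗)
open import Data.Maybe.Properties using (just-injective)
open import Data.Nat using (ℕ; zero; suc; _+_; _*_; _∸_; _⊔_; _≤_; _<_; _≤?_; z≤n; s≤s)
open import Data.Nat.Divisibility
  using (_∣_; _∣0; ∣-refl; ∣1⇒≡1; ∣m∣n⇒∣m+n; ∣m+n∣m⇒∣n)
open import Data.Nat.Induction using (<-wellFounded)
open import Data.Nat.ListAction using (sum)
open import Data.Nat.ListAction.Properties using (sum-++)
open import Data.Product using (_×_; Σ; _,_; proj₁; proj₂)
open import Data.Sum using (_⊎_; inj₁; inj₂)
open import Data.Unit using (tt)
open import Function using (_∘_)
open import Function.Bundles using (_⇔_; mk⇔)
open import Induction.WellFounded using (Acc; acc)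
open import Level using (0ℓ)
open import Relation.Binary using (Rel; Reflexive)
open import Relation.Binary.PropositionalEquality hiding ([_])
open import Relation.Nullary using (¬_; ¬?; yes; no)

Step : ℕ → ℕ → Set
Step x y = y ≡ x ⊎ y ≡ suc x

Step⇒≤ : ∀ {x y} → Step x y → x ≤ y
Step⇒≤ (inj₁ refl) = ≤-refl
Step⇒≤ (inj₂ refl) = n≤1+n _

Step⇒≤suc : ∀ {x y} → Step x y → y ≤ suc x
Step⇒≤suc (inj₁ refl) = n≤1+n _
Step⇒≤suc (inj₂ refl) = ≤-refl

Step-refl : ∀ {x} → Step x x
Step-refl = inj₁ refl

Step-+ʳ : ∀ k {x y} → Step x y → Step (x + k) (y + k)
Step-+ʳ k (inj₁ refl) = inj₁ refl
Step-+ʳ k (inj₂ refl) = inj₂ refl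

Step-+ˡ : ∀ k {x y} → Step x y → Step (k + x) (k + y)
Step-+ˡ k (inj₁ refl) = inj₁ refl
Step-+ˡ k {x} (inj₂ refl) = inj₂ (+-suc k x)

Step-cancelʳ-+ : ∀ k {x y} → Step (x + k) (y + k) → Step x y
Step-cancelʳ-+ k {x} {y} (inj₁ e) = inj₁ (+-cancelʳ-≡ k y x e)
Step-cancelʳ-+ k {x} {y} (inj₂ e) = inj₂ (+-cancelʳ-≡ k y (suc x) e)

Step-+ˡ⇒≤suc : ∀ x {a b} → Step (x + a) (x + b) → b ≤ suc a
Step-+ˡ⇒≤suc x {a} {b} s =
  +-cancelˡ-≤ x b (suc a) (subst (x + b ≤_) (sym (+-suc x a)) (Step⇒≤suc s))

Step-+⇒≤1 : ∀ {x ℓ} → Step x (x + ℓ) → ℓ ≤ 1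
Step-+⇒≤1 {x} {ℓ} s =
  Step-+ˡ⇒≤suc x (subst (λ y → Step y (x + ℓ)) (sym (+-identityʳ x)) s)

Contiguous : List ℕ → Set
Contiguous = Linked Step

Contiguous⇒Sorted : ∀ {xs} → Contiguous xs → Linked _≤_ xs
Contiguous⇒Sorted = Linked.map Step⇒≤

2∤1 : ¬ 2 ∣ 1
2∤1 2∣1 with ∣1⇒≡1 2∣1
... | ()

even⇒¬odd : ∀ {m} → 2 ∣ m → ¬ 2 ∣ suc m
even⇒¬odd {m} 2∣m 2∣1+m = 2∤1 (∣m+n∣m⇒∣n (subst (2 ∣_) (+-comm 1 m) 2∣1+m) 2∣m)

even⇒2≤ : ∀ {ℓ} → 2 ∣ ℓ → 1 ≤ ℓ → 2 ≤ ℓ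
even⇒2≤ {suc zero} 2∣1 _ = ⊥-elim (2∤1 2∣1)
even⇒2≤ {suc (suc ℓ)} _ _ = s≤s (s≤s z≤n)

∃-even-Step : ∀ w → Σ ℕ λ ℓ → 2 ∣ ℓ × Step w ℓ
∃-even-Step zero = 0 , 2 ∣0 , Step-refl
∃-even-Step (suc w) with ∃-even-Step w
... | ℓ , 2∣ℓ , inj₁ refl = suc (suc w) , ∣m∣n⇒∣m+n ∣-refl 2∣ℓ , inj₂ refl
... | ℓ , 2∣ℓ , inj₂ refl = ℓ , 2∣ℓ , Step-refl

EvenWidth : ℕ → Set
EvenWidth ℓ = 2 ≤ ℓ × 2 ∣ ℓ

Step-even-unique : ∀ {b x ℓ₁ ℓ₂} → 2 ∣ ℓ₁ → 2 ∣ ℓ₂ →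
                   Step b (x + ℓ₁) → Step b (x + ℓ₂) → ℓ₁ ≡ ℓ₂
Step-even-unique {x = x} _ _ (inj₁ e₁) (inj₁ e₂) = +-cancelˡ-≡ x _ _ (trans e₁ (sym e₂))
Step-even-unique {x = x} _ _ (inj₂ e₁) (inj₂ e₂) = +-cancelˡ-≡ x _ _ (trans e₁ (sym e₂))
Step-even-unique 2∣ℓ₁ 2∣ℓ₂ (inj₁ e₁) (inj₂ e₂) =
  ⊥-elim (even⇒¬odd 2∣ℓ₁ (subst (2 ∣_) (one-apart e₁ e₂) 2∣ℓ₂))
  where
  one-apart : ∀ {b x a c} → x + a ≡ b → x + c ≡ suc b → c ≡ suc a
  one-apart {x = x} {a} refl e = +-cancelˡ-≡ x _ _ (trans e (sym (+-suc x a)))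
Step-even-unique 2∣ℓ₁ 2∣ℓ₂ (inj₂ e₁) (inj₁ e₂) =
  sym (Step-even-unique 2∣ℓ₂ 2∣ℓ₁ (inj₁ e₂) (inj₂ e₁))

module _ {A : Set} where

  lastOf : A → List A → A
  lastOf x [] = x
  lastOf _ (y ∷ t) = lastOf y t

  initOf : A → List A → List A
  initOf x [] = []
  initOf x (y ∷ t) = x ∷ initOf y t

  ∷≡initOf∷ʳlastOf : ∀ x t → x ∷ t ≡ initOf x t ∷ʳ lastOf x t
  ∷≡initOf∷ʳlastOf x [] = refl
  ∷≡initOf∷ʳlastOf x (y ∷ t) = cong (x ∷_) (∷≡initOf∷ʳlastOf y t)

  lastOf-++-∷ : ∀ x ys z zs → lastOf x (ys ++ z ∷ zs) ≡ lastOf z zs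
  lastOf-++-∷ x [] z zs = refl
  lastOf-++-∷ x (y ∷ ys) z zs = lastOf-++-∷ y ys z zs

  lastOf-∷ʳ : ∀ x ys z → lastOf x (ys ∷ʳ z) ≡ z
  lastOf-∷ʳ x ys z = lastOf-++-∷ x ys z []

  lastOf-replicate : ∀ k x → lastOf x (replicate k x) ≡ x
  lastOf-replicate zero x = refl
  lastOf-replicate (suc k) x = lastOf-replicate k x

  lastOf-pad : ∀ x t k → lastOf x (t ++ replicate k (lastOf x t)) ≡ lastOf x t
  lastOf-pad x [] k = lastOf-replicate k x
  lastOf-pad x (y ∷ t) k = lastOf-pad y t k

  replicate-+ : ∀ m k (x : A) → replicate m x ++ replicate k x ≡ replicate (m + k) x
  replicate-+ zero k x = refl
  replicate-+ (suc m) k x = cong (x ∷_) (replicate-+ m k x)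

  ++-replicate-+ : ∀ xs m k (x : A) →
                   (xs ++ replicate m x) ++ replicate k x ≡ xs ++ replicate (m + k) x
  ++-replicate-+ xs m k x = trans (++-assoc xs _ _) (cong (xs ++_) (replicate-+ m k x))

  iterate-suc : ∀ (f : A → A) k a → iterate f (suc k) a ≡ iterate f k (f a)
  iterate-suc f zero a = refl
  iterate-suc f (suc k) a = cong f (iterate-suc f k a)

  module _ {R : Rel A 0ℓ} where

    Linked-∷ʳ : ∀ {x t z} → Linked R (x ∷ t) → R (lastOf x t) z → Linked R (x ∷ t ∷ʳ z)
    Linked-∷ʳ {t = []} _ r = r ∷ [-]
    Linked-∷ʳ {t = y ∷ t} (r ∷ rs) r′ = r ∷ Linked-∷ʳ rs r′

    Linked-initOf : ∀ {x t} → Linked R (x ∷ t) → Linked R (initOf x t)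
    Linked-initOf {t = []} _ = []
    Linked-initOf {t = y ∷ []} _ = [-]
    Linked-initOf {t = y ∷ z ∷ t} (r ∷ rs) = r ∷ Linked-initOf rs

    Linked-last : ∀ {x y r} → Linked R (x ∷ y ∷ r) →
                  R (lastOf x (initOf y r)) (lastOf y r)
    Linked-last {r = []} (r ∷ _) = r
    Linked-last {r = z ∷ r} (_ ∷ rs) = Linked-last rs

    Linked-replicate : Reflexive R → ∀ {x} k → Linked R (x ∷ replicate k x)
    Linked-replicate refl′ zero = [-]
    Linked-replicate refl′ (suc k) = refl′ ∷ Linked-replicate refl′ k

    Linked-pad : Reflexive R → ∀ {x t} k → Linked R (x ∷ t) →
                 Linked R (x ∷ t ++ replicate k (lastOf x t))
    Linked-pad refl′ {t = []} k _ = Linked-replicate refl′ k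
    Linked-pad refl′ {t = y ∷ t} k (r ∷ rs) = r ∷ Linked-pad refl′ k rs

    Linked-resize : Reflexive R → ∀ xs {y ys} d → Linked R (xs ++ y ∷ ys) →
                    Linked R (xs ++ y ∷ replicate d y)
    Linked-resize refl′ [] d _ = Linked-replicate refl′ d
    Linked-resize refl′ (x ∷ []) d (r ∷ _) = r ∷ Linked-replicate refl′ d
    Linked-resize refl′ (x ∷ x′ ∷ xs) d (r ∷ rs) = r ∷ Linked-resize refl′ (x′ ∷ xs) d rs

≤-lastOf : ∀ {x t} → Linked _≤_ (x ∷ t) → x ≤ lastOf x t
≤-lastOf {t = []} _ = ≤-refl
≤-lastOf {t = y ∷ t} (x≤y ∷ rs) = ≤-trans x≤y (≤-lastOf rs)

maxPart≡lastOf : ∀ {x t} → Linked _≤_ (x ∷ t) → maxPart (x ∷ t) ≡ lastOf x t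
maxPart≡lastOf {x} {[]} _ = ⊔-identityʳ x
maxPart≡lastOf {x} {y ∷ t} (x≤y ∷ rs) =
  trans (cong (x ⊔_) (maxPart≡lastOf rs)) (m≤n⇒m⊔n≡n (≤-trans x≤y (≤-lastOf rs)))

interval : ℕ → ℕ → List ℕ
interval a zero = []
interval a (suc N) = a ∷ interval (suc a) N

length-interval : ∀ a N → length (interval a N) ≡ N
length-interval a zero = refl
length-interval a (suc N) = cong suc (length-interval (suc a) N)

Consecutive-interval : ∀ a N → Consecutive (interval a N)
Consecutive-interval a zero = tt
Consecutive-interval a (suc zero) = tt
Consecutive-interval a (suc (suc N)) = refl , Consecutive-interval (suc a) (suc N)

take-interval : ∀ a n N → n ≤ N → take n (interval a N) ≡ interval a n
take-interval a zero N _ = refl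
take-interval a (suc n) (suc N) (s≤s n≤N) = cong (a ∷_) (take-interval (suc a) n N n≤N)

map-suc-interval : ∀ a N → map suc (interval a N) ≡ interval (suc a) N
map-suc-interval a zero = refl
map-suc-interval a (suc N) = cong (suc a ∷_) (map-suc-interval (suc a) N)

interval-∷ʳ : ∀ a N → interval a (suc N) ≡ interval a N ∷ʳ (a + N)
interval-∷ʳ a zero = cong [_] (sym (+-identityʳ a))
interval-∷ʳ a (suc N) = cong (a ∷_) (trans (interval-∷ʳ (suc a) N)
                                          (cong (interval (suc a) N ∷ʳ_) (sym (+-suc a N))))

map-suc-interval-∷ʳ : ∀ x r →
                      map suc (interval x (suc r)) ≡ interval (suc x) r ∷ʳ (x + suc r)
map-suc-interval-∷ʳ x r = begin
  map suc (interval x (suc r))      ≡⟨ map-suc-interval x (suc r) ⟩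
  interval (suc x) (suc r)          ≡⟨ interval-∷ʳ (suc x) r ⟩
  interval (suc x) r ∷ʳ suc (x + r) ≡⟨ cong (interval (suc x) r ∷ʳ_) (+-suc x r) ⟨
  interval (suc x) r ∷ʳ (x + suc r) ∎
  where open ≡-Reasoning

distinct-∷-∷ : ∀ x r → distinct (x ∷ x ∷ r) ≡ distinct (x ∷ r)
distinct-∷-∷ x r = cong (x ∷_) (trans (filter-reject (¬? ∘ _≟_ x) (λ x≢x → x≢x refl))
                                       (filter-idem (¬? ∘ _≟_ x) (distinct r)))

distinct-∷-fresh : ∀ {x t} → All (x <_) t → distinct (x ∷ t) ≡ x ∷ distinct t
distinct-∷-fresh x<t = cong (_ ∷_) (filter-all (¬? ∘ _≟_ _) (All.deduplicate⁺ _≟_ x≢t))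
  where x≢t = All.map (λ x<y x≡y → <-irrefl x≡y x<y) x<t

distinct-contiguous : ∀ {x t} → Contiguous (x ∷ t) →
                      Σ ℕ λ w → lastOf x t ≡ x + w × distinct (x ∷ t) ≡ interval x (suc w)
distinct-contiguous {x} {[]} _ = 0 , sym (+-identityʳ x) , refl
distinct-contiguous {x} {.x ∷ r} (inj₁ refl ∷ s) with distinct-contiguous s
... | w , last≡ , distinct≡ = w , last≡ , trans (distinct-∷-∷ x r) distinct≡
distinct-contiguous {x} {.(suc x) ∷ r} (inj₂ refl ∷ s) with distinct-contiguous s
... | w , last≡ , distinct≡ =
  suc w , trans last≡ (sym (+-suc x w)) ,
  trans (distinct-∷-fresh (Linked⇒All ≤-trans ≤-refl (Contiguous⇒Sorted s)))
        (cong (x ∷_) distinct≡)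

ℓ̄-contiguous : ∀ {x t} → Contiguous (x ∷ t) → x + ℓ̄ (x ∷ t) ≡ suc (lastOf x t)
ℓ̄-contiguous {x} {t} s with distinct-contiguous s
... | w , last≡ , distinct≡ = begin
  x + ℓ̄ (x ∷ t)                    ≡⟨ cong (λ vs → x + length vs) distinct≡ ⟩
  x + length (interval x (suc w))  ≡⟨ cong (x +_) (length-interval x (suc w)) ⟩
  x + suc w                        ≡⟨ +-suc x w ⟩
  suc (x + w)                      ≡⟨ cong suc last≡ ⟨
  suc (lastOf x t)                 ∎
  where open ≡-Reasoning

Contiguous⇒GapFree : ∀ {xs} → Contiguous xs → GapFree xs
Contiguous⇒GapFree {[]} _ = tt
Contiguous⇒GapFree {x ∷ t} s with distinct-contiguous s
... | w , _ , distinct≡ = subst Consecutive (sym distinct≡) (Consecutive-interval x (suc w))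

GapFree⇒Contiguous : ∀ {xs} → Linked _≤_ xs → GapFree xs → Contiguous xs
GapFree⇒Contiguous {[]} _ _ = []
GapFree⇒Contiguous {x ∷ []} _ _ = [-]
GapFree⇒Contiguous {x ∷ y ∷ r} (x≤y ∷ sorted) gf with x ≟ y
... | yes refl = inj₁ refl ∷ GapFree⇒Contiguous sorted (subst Consecutive (distinct-∷-∷ x r) gf)
... | no x≢y
  with subst Consecutive (distinct-∷-fresh (Linked⇒All ≤-trans (≤∧≢⇒< x≤y x≢y) sorted)) gf
...   | y≡1+x , gf′ = inj₂ y≡1+x ∷ GapFree⇒Contiguous sorted gf′

↭-removeOne : ∀ {v} L → v ∈ L → L ↭ v ∷ removeOne v L
↭-removeOne {v} (x ∷ xs) v∈L with x ≟ v
... | yes refl = ↭-refl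
↭-removeOne {v} (x ∷ xs) (here refl) | no x≢v = ⊥-elim (x≢v refl)
↭-removeOne {v} (x ∷ xs) (there v∈xs) | no _ =
  ↭-trans (prep x (↭-removeOne xs v∈xs)) (swap x v ↭-refl)

↭-removeAll : ∀ L {vs} → Unique vs → All (_∈ L) vs → L ↭ vs ++ foldr removeOne L vs
↭-removeAll L [] [] = ↭-refl
↭-removeAll L {v ∷ vs} (v∉vs ∷ u) (v∈L ∷ vs⊆L) = begin
  L                        ↭⟨ L↭vs++R ⟩
  vs ++ R                  ↭⟨ ++⁺ˡ vs (↭-removeOne R v∈R) ⟩
  vs ++ v ∷ removeOne v R  ↭⟨ shift v vs (removeOne v R) ⟩
  v ∷ vs ++ removeOne v R  ∎
  where
  open PermutationReasoning
  R = foldr removeOne L vs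
  L↭vs++R = ↭-removeAll L u vs⊆L
  v∈R : v ∈ R
  v∈R with ∈-++⁻ vs (∈-resp-↭ L↭vs++R v∈L)
  ... | inj₁ v∈vs = ⊥-elim (All.lookup v∉vs v∈vs refl)
  ... | inj₂ v∈R = v∈R

sort-↭-sorted : ∀ {xs ys} → Linked _≤_ ys → xs ↭ ys → sort xs ≡ ys
sort-↭-sorted {xs} ys↗ xs↭ys =
  Pointwise-≡⇒≡ (Sorted.↗↭↗⇒≋ ≤-totalOrder (sort-↗ xs) ys↗
                                (↭⇒↭ₛ (↭-trans (sort-↭ xs) xs↭ys)))

ξ-interval : ∀ r {x t} → take (suc r) (distinct (x ∷ t)) ≡ interval x (suc r) →
             Linked _≤_ (t ∷ʳ (x + suc r)) → ξ (suc r) (x ∷ t) ≡ t ∷ʳ (x + suc r)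
ξ-interval r {x} {t} vs≡ sorted = sort-↭-sorted sorted (begin
  map suc vs ++ R          ≡⟨ cong (_++ R) shifted ⟩
  (I ∷ʳ z) ++ R            ≡⟨ ++-assoc I [ z ] R ⟩
  I ++ [ z ] ++ R          ↭⟨ shift z I R ⟩
  z ∷ I ++ R               ↭⟨ ∷↭∷ʳ z (I ++ R) ⟩
  (I ++ R) ∷ʳ z            ↭⟨ ++⁺ʳ [ z ] (↭-sym (drop-∷ split)) ⟩
  t ∷ʳ z                   ∎)
  where
  open PermutationReasoning
  vs = take (suc r) (distinct (x ∷ t))
  R = foldr removeOne (x ∷ t) vs
  I = interval (suc x) r
  z = x + suc r
  vs⊆L : All (_∈ x ∷ t) vs
  vs⊆L = All.take⁺ (suc r) (All.tabulate (∈-deduplicate⁻ _≟_ (x ∷ t)))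
  split : x ∷ t ↭ x ∷ I ++ R
  split = subst (λ us → x ∷ t ↭ us ++ R) vs≡
            (↭-removeAll (x ∷ t) (take⁺ (suc r) (deduplicate-! (x ∷ t))) vs⊆L)
  shifted : map suc vs ≡ I ∷ʳ z
  shifted = trans (cong (map suc) vs≡) (map-suc-interval-∷ʳ x r)

Window : ℕ → List ℕ → Set
Window ℓ [] = ⊥
Window ℓ (x ∷ t) = Contiguous (x ∷ t) × 1 ≤ x × Step (lastOf x t) (x + ℓ)

rotate : ℕ → List ℕ → List ℕ
rotate ℓ [] = []
rotate ℓ (x ∷ t) = t ∷ʳ (x + ℓ)

window-singleton : ∀ {ℓ x} → Window ℓ [ x ] → ℓ ≤ 1
window-singleton (_ , _ , step) = Step-+⇒≤1 step

rotate-window : ∀ {ℓ L} → 2 ≤ ℓ → Window ℓ L → Window ℓ (rotate ℓ L)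
rotate-window {L = x ∷ []} 2≤ℓ w = ⊥-elim (<-irrefl refl (≤-trans 2≤ℓ (window-singleton w)))
rotate-window {ℓ} {x ∷ y ∷ r} _ (x~y ∷ s , 1≤x , last~) =
  Linked-∷ʳ s last~ , ≤-trans 1≤x (Step⇒≤ x~y) ,
  subst (λ b → Step b (y + ℓ)) (sym (lastOf-∷ʳ y r (x + ℓ))) (Step-+ʳ ℓ x~y)

rotations-window : ∀ {ℓ L} → 2 ≤ ℓ → Window ℓ L → ∀ k →
                   Window ℓ (iterate (rotate ℓ) k L)
rotations-window 2≤ℓ w zero = w
rotations-window 2≤ℓ w (suc k) = rotate-window 2≤ℓ (rotations-window 2≤ℓ w k)

ξ-window : ∀ {ℓ L} → 1 ≤ ℓ → Window ℓ L → ξ ℓ L ≡ rotate ℓ L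
ξ-window {suc r} {x ∷ t} _ (s , _ , last~) with distinct-contiguous s
... | w , last≡ , distinct≡ =
  ξ-interval r (trans (cong (take (suc r)) distinct≡) (take-interval x (suc r) (suc w) ℓ≤1+w))
    (Linked.tail (Contiguous⇒Sorted (Linked-∷ʳ s last~)))
  where
  ℓ≤1+w : suc r ≤ suc w
  ℓ≤1+w = Step-+ˡ⇒≤suc x (subst (λ b → Step b (x + suc r)) last≡ last~)

ξ-rotations : ∀ {ℓ L} → 2 ≤ ℓ → Window ℓ L → ∀ k →
              iterate (ξ ℓ) k L ≡ iterate (rotate ℓ) k L
ξ-rotations 2≤ℓ w zero = refl
ξ-rotations {ℓ} 2≤ℓ w (suc k) =
  trans (cong (ξ ℓ) (ξ-rotations 2≤ℓ w k))
        (ξ-window (<⇒≤ 2≤ℓ) (rotations-window 2≤ℓ w k))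

sum-rotate : ∀ {ℓ L} → Window ℓ L → sum (rotate ℓ L) ≡ sum L + ℓ
sum-rotate {ℓ} {x ∷ t} _ = begin
  sum (t ∷ʳ (x + ℓ))    ≡⟨ sum-++ t [ x + ℓ ] ⟩
  sum t + (x + ℓ + 0)   ≡⟨ cong (sum t +_) (+-identityʳ (x + ℓ)) ⟩
  sum t + (x + ℓ)       ≡⟨ +-assoc (sum t) x ℓ ⟨
  sum t + x + ℓ         ≡⟨ cong (_+ ℓ) (+-comm (sum t) x) ⟩
  x + sum t + ℓ         ∎
  where open ≡-Reasoning

sum-rotations : ∀ {ℓ L} → 2 ≤ ℓ → Window ℓ L → ∀ k →
                sum (iterate (rotate ℓ) k L) ≡ sum L + k * ℓ
sum-rotations {ℓ} {L} 2≤ℓ w zero = sym (+-identityʳ (sum L))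
sum-rotations {ℓ} {L} 2≤ℓ w (suc k) = begin
  sum (rotate ℓ (iterate (rotate ℓ) k L))  ≡⟨ sum-rotate (rotations-window 2≤ℓ w k) ⟩
  sum (iterate (rotate ℓ) k L) + ℓ         ≡⟨ cong (_+ ℓ) (sum-rotations 2≤ℓ w k) ⟩
  sum L + k * ℓ + ℓ                        ≡⟨ +-assoc (sum L) (k * ℓ) ℓ ⟩
  sum L + (k * ℓ + ℓ)                      ≡⟨ cong (sum L +_) (+-comm (k * ℓ) ℓ) ⟩
  sum L + suc k * ℓ                        ∎
  where open ≡-Reasoning

rotate-injective : ∀ {ℓ L L′} → rotate ℓ L ≡ rotate ℓ L′ → L ≡ L′
rotate-injective {L = []} {[]} _ = refl
rotate-injective {L = []} {_ ∷ []} ()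
rotate-injective {L = []} {_ ∷ _ ∷ _} ()
rotate-injective {L = _ ∷ []} {[]} ()
rotate-injective {L = _ ∷ _ ∷ _} {[]} ()
rotate-injective {ℓ} {x ∷ t} {y ∷ u} eq with ∷ʳ-injective t u eq
... | t≡u , x+ℓ≡y+ℓ = cong₂ _∷_ (+-cancelʳ-≡ ℓ x y x+ℓ≡y+ℓ) t≡u

window-width-unique : ∀ {ℓ₁ ℓ₂ L} → Window ℓ₁ L → Window ℓ₂ L → 2 ∣ ℓ₁ → 2 ∣ ℓ₂ → ℓ₁ ≡ ℓ₂
window-width-unique {L = x ∷ t} (_ , _ , last~₁) (_ , _ , last~₂) 2∣ℓ₁ 2∣ℓ₂ =
  Step-even-unique 2∣ℓ₁ 2∣ℓ₂ last~₁ last~₂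

positive-parts : ∀ {x t} → Contiguous (x ∷ t) → 1 ≤ x → All (0 <_) (x ∷ t)
positive-parts s 1≤x = Linked⇒All ≤-trans 1≤x (Contiguous⇒Sorted s)

window⇒G∖G0 : ∀ {n ℓ L} → 2 ≤ ℓ → Window ℓ L → sum L ≡ n → InG n L × ¬ InG0 n L
window⇒G∖G0 {n} {ℓ} {x ∷ t} 2≤ℓ (s , 1≤x , last~) sum≡n =
  ((Contiguous⇒Sorted s , positive-parts s 1≤x , sum≡n) , Contiguous⇒GapFree s) , single-valued
  where
  single-valued : ¬ InG0 n (x ∷ t)
  single-valued (_ , ℓ̄≡1) =
    <-irrefl refl (≤-trans 2≤ℓ (Step-+⇒≤1 (subst (λ b → Step b (x + ℓ)) last≡x last~)))
    where
    last≡x : lastOf x t ≡ x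
    last≡x = suc-injective (trans (sym (ℓ̄-contiguous s)) (trans (cong (x +_) ℓ̄≡1) (+-comm x 1)))

Seed : ℕ → List ℕ → Set
Seed ℓ [] = ⊥
Seed ℓ (x ∷ t) = x ≡ 1 × Contiguous (x ∷ t) × lastOf x t ≡ ℓ

seed⇒window : ∀ {ℓ ν} → Seed ℓ ν → Window ℓ ν
seed⇒window {ν = x ∷ t} (refl , s , refl) = s , ≤-refl , inj₂ refl

seed-pad : ∀ {ℓ ν} k → Seed ℓ ν → Seed ℓ (ν ++ replicate k ℓ)
seed-pad {ν = x ∷ t} k (x≡1 , s , refl) = x≡1 , Linked-pad Step-refl k s , lastOf-pad x t k

seed-resize : ∀ {ℓ} P c d → Seed ℓ (P ++ replicate (suc c) ℓ) →
              Seed ℓ (P ++ replicate (suc d) ℓ)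
seed-resize {ℓ} [] c d (ℓ≡1 , _ , _) =
  ℓ≡1 , Linked-replicate Step-refl d , lastOf-replicate d ℓ
seed-resize {ℓ} (p ∷ P) c d (p≡1 , s , _) =
  p≡1 , Linked-resize Step-refl (p ∷ P) d s , trans (lastOf-++-∷ p P ℓ _) (lastOf-replicate d ℓ)

ℓ̄-seed : ∀ {ℓ ν} → Seed ℓ ν → ℓ̄ ν ≡ ℓ
ℓ̄-seed {ν = x ∷ t} (refl , s , refl) = suc-injective (ℓ̄-contiguous s)

maxPart-seed : ∀ {ℓ ν} → Seed ℓ ν → maxPart ν ≡ ℓ
maxPart-seed {ν = x ∷ t} (_ , s , refl) = maxPart≡lastOf (Contiguous⇒Sorted s)

seed⇒GI' : ∀ {n ℓ ν} → Seed ℓ ν → 2 ∣ ℓ → sum ν ≡ n → InGI' n ν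
seed⇒GI' {ν = x ∷ t} seed@(refl , s , _) 2∣ℓ sum≡n =
  ((Contiguous⇒Sorted s , positive-parts s ≤-refl , sum≡n) , Contiguous⇒GapFree s) ,
  refl , subst (2 ∣_) (sym (maxPart-seed seed)) 2∣ℓ

GI'⇒seed : ∀ {n λ'} → InGI' n λ' → Seed (ℓ̄ λ') λ'
GI'⇒seed {λ' = x ∷ t} (((sorted , _) , gf) , head≡ , _) with just-injective head≡
... | refl = subst (λ ℓ → Seed ℓ (1 ∷ t)) (sym (ℓ̄-seed seed)) seed
  where
  seed : Seed (lastOf 1 t) (1 ∷ t)
  seed = refl , GapFree⇒Contiguous sorted gf , refl

GI'-width : ∀ {n λ'} → InGI' n λ' → EvenWidth (ℓ̄ λ')
GI'-width {λ' = x ∷ t} g@(_ , _ , 2∣max) = even⇒2≤ 2∣ℓ̄ (s≤s z≤n) , 2∣ℓ̄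
  where
  2∣ℓ̄ : 2 ∣ ℓ̄ (x ∷ t)
  2∣ℓ̄ = subst (2 ∣_) (maxPart-seed (GI'⇒seed g)) 2∣max

window⇒seed : ∀ {ℓ x t} → Window ℓ (x ∷ t) → lastOf x t ≤ ℓ → Seed ℓ (x ∷ t)
window⇒seed {ℓ} (s , 1≤x , inj₁ x+ℓ≡b) b≤ℓ =
  ⊥-elim (<-irrefl refl (≤-trans (+-monoˡ-≤ ℓ 1≤x) (≤-trans (≤-reflexive x+ℓ≡b) b≤ℓ)))
window⇒seed {ℓ} {x} (s , 1≤x , inj₂ x+ℓ≡1+b) b≤ℓ
  with ≤-antisym (+-cancelʳ-≤ ℓ x 1 (≤-trans (≤-reflexive x+ℓ≡1+b) (s≤s b≤ℓ))) 1≤x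
... | refl = refl , s , sym (suc-injective x+ℓ≡1+b)

unrotate-step : ∀ {ℓ x t} → 2 ≤ ℓ → Window ℓ (x ∷ t) → ℓ < lastOf x t →
                Σ (List ℕ) λ L′ → Window ℓ L′ × rotate ℓ L′ ≡ x ∷ t
unrotate-step {t = []} 2≤ℓ w _ = ⊥-elim (<-irrefl refl (≤-trans 2≤ℓ (window-singleton w)))
unrotate-step {ℓ} {x} {y ∷ r} _ (s , _ , b~x+ℓ) ℓ<b =
  c ∷ x ∷ initOf y r ,
  (Step-cancelʳ-+ ℓ (subst (λ b → Step b (x + ℓ)) (sym c+ℓ≡b) b~x+ℓ) ∷ Linked-initOf s ,
   m<n⇒0<n∸m ℓ<b ,
   subst (Step _) (sym c+ℓ≡b) (Linked-last s)) ,
  trans (cong (initOf x (y ∷ r) ∷ʳ_) c+ℓ≡b) (sym (∷≡initOf∷ʳlastOf x (y ∷ r)))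
  where
  c = lastOf y r ∸ ℓ
  c+ℓ≡b : c + ℓ ≡ lastOf y r
  c+ℓ≡b = m∸n+n≡m (<⇒≤ ℓ<b)

sum-<-rotate : ∀ {ℓ L} → 1 ≤ ℓ → Window ℓ L → sum L < sum (rotate ℓ L)
sum-<-rotate {L = L} 1≤ℓ w = subst (sum L <_) (sym (sum-rotate w)) (m<m+n (sum L) 1≤ℓ)

unrotate : ∀ {ℓ L} → 2 ≤ ℓ → Window ℓ L →
           Σ (List ℕ) λ ν → Σ ℕ λ k → Seed ℓ ν × L ≡ iterate (rotate ℓ) k ν
unrotate {ℓ} {L} 2≤ℓ w = go L w (<-wellFounded (sum L))
  where
  1≤ℓ : 1 ≤ ℓ
  1≤ℓ = <⇒≤ 2≤ℓ
  go : ∀ L → Window ℓ L → Acc _<_ (sum L) →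
       Σ (List ℕ) λ ν → Σ ℕ λ k → Seed ℓ ν × L ≡ iterate (rotate ℓ) k ν
  go (x ∷ t) w (acc smaller) with lastOf x t ≤? ℓ
  ... | yes b≤ℓ = x ∷ t , 0 , window⇒seed w b≤ℓ , refl
  ... | no b≰ℓ with unrotate-step 2≤ℓ w (≰⇒> b≰ℓ)
  ...   | L′ , w′ , rot≡
          with go L′ w′ (smaller (subst (sum L′ <_) (cong sum rot≡) (sum-<-rotate 1≤ℓ w′)))
  ...     | ν , k , seed , L′≡ = ν , suc k , seed , trans (sym rot≡) (cong (rotate ℓ) L′≡)

seed-not-rotation : ∀ {ℓ ν L} → Seed ℓ ν → Window ℓ L → ν ≢ rotate ℓ L
seed-not-rotation {ℓ} {x ∷ t} {y ∷ u} (_ , _ , last≡ℓ) (_ , 1≤y , _) ν≡ =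
  <-irrefl (trans (sym last≡ℓ) last≡y+ℓ) (m<n+m ℓ 1≤y)
  where
  last≡y+ℓ : lastOf x t ≡ y + ℓ
  last≡y+ℓ = ∷ʳ-injectiveʳ (initOf x t) u (trans (sym (∷≡initOf∷ʳlastOf x t)) ν≡)

rotations-injective : ∀ {ℓ ν₁ ν₂} → 2 ≤ ℓ → Seed ℓ ν₁ → Seed ℓ ν₂ → ∀ k₁ k₂ →
                      iterate (rotate ℓ) k₁ ν₁ ≡ iterate (rotate ℓ) k₂ ν₂ →
                      k₁ ≡ k₂ × ν₁ ≡ ν₂
rotations-injective 2≤ℓ s₁ s₂ zero zero eq = refl , eq
rotations-injective 2≤ℓ s₁ s₂ zero (suc k₂) eq =
  ⊥-elim (seed-not-rotation s₁ (rotations-window 2≤ℓ (seed⇒window s₂) k₂) eq)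
rotations-injective 2≤ℓ s₁ s₂ (suc k₁) zero eq =
  ⊥-elim (seed-not-rotation s₂ (rotations-window 2≤ℓ (seed⇒window s₁) k₁) (sym eq))
rotations-injective 2≤ℓ s₁ s₂ (suc k₁) (suc k₂) eq
  with rotations-injective 2≤ℓ s₁ s₂ k₁ k₂ (rotate-injective eq)
... | refl , ν₁≡ν₂ = refl , ν₁≡ν₂

count : ℕ → List ℕ → ℕ
count v xs = length (filter (_≟ v) xs)

split-top : ∀ {x t} → Linked _≤_ (x ∷ t) →
            Σ (List ℕ) λ P → Σ ℕ λ c →
              x ∷ t ≡ P ++ replicate (suc c) (lastOf x t) × All (_< lastOf x t) P
split-top {x} {[]} _ = [] , 0 , refl , []
split-top {x} {y ∷ r} (x≤y ∷ sorted)
  with split-top sorted | m≤n⇒m<n∨m≡n (≤-trans x≤y (≤-lastOf sorted))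
... | P , c , y∷r≡ , P<b | inj₁ x<b = x ∷ P , c , cong (x ∷_) y∷r≡ , x<b ∷ P<b
... | [] , c , y∷r≡ , [] | inj₂ refl = [] , suc c , cong (x ∷_) y∷r≡ , []
... | z ∷ P , c , y∷r≡ , z<b ∷ _ | inj₂ refl =
  ⊥-elim (<-irrefl refl (≤-<-trans (≤-trans x≤y (≤-reflexive (∷-injectiveˡ y∷r≡))) z<b))

count-top : ∀ {ℓ} P m → All (_< ℓ) P → count ℓ (P ++ replicate m ℓ) ≡ m
count-top {ℓ} P m P<ℓ = begin
  length (keep (P ++ replicate m ℓ))       ≡⟨ cong length (filter-++ (_≟ ℓ) P _) ⟩
  length (keep P ++ keep (replicate m ℓ))  ≡⟨ cong₂ (λ u v → length (u ++ v)) none all ⟩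
  length (replicate m ℓ)                   ≡⟨ length-replicate m ⟩
  m                                        ∎
  where
  open ≡-Reasoning
  keep = filter (_≟ ℓ)
  none = filter-none (_≟ ℓ) (All.map (λ p<ℓ p≡ℓ → <-irrefl p≡ℓ p<ℓ) P<ℓ)
  all = filter-all (_≟ ℓ) (All.replicate⁺ m refl)

removeOne-top : ∀ {ℓ} P r → All (_< ℓ) P → removeOne ℓ (P ++ ℓ ∷ r) ≡ P ++ r
removeOne-top {ℓ} [] r _ with ℓ ≟ ℓ
... | yes _ = refl
... | no ℓ≢ℓ = ⊥-elim (ℓ≢ℓ refl)
removeOne-top {ℓ} (p ∷ P) r (p<ℓ ∷ P<ℓ) with p ≟ ℓ
... | yes p≡ℓ = ⊥-elim (<-irrefl p≡ℓ p<ℓ)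
... | no _ = cong (p ∷_) (removeOne-top P r P<ℓ)

removeOne-top-iterate : ∀ {ℓ} P k d → All (_< ℓ) P →
                        iterate (removeOne ℓ) k (P ++ replicate (k + d) ℓ) ≡ P ++ replicate d ℓ
removeOne-top-iterate P zero d _ = refl
removeOne-top-iterate {ℓ} P (suc k) d P<ℓ = begin
  iterate (removeOne ℓ) (suc k) (P ++ ℓ ∷ replicate (k + d) ℓ)    ≡⟨ iterate-suc (removeOne ℓ) k _ ⟩
  iterate (removeOne ℓ) k (removeOne ℓ (P ++ ℓ ∷ replicate (k + d) ℓ))
    ≡⟨ cong (iterate (removeOne ℓ) k) (removeOne-top P _ P<ℓ) ⟩
  iterate (removeOne ℓ) k (P ++ replicate (k + d) ℓ)            ≡⟨ removeOne-top-iterate P k d P<ℓ ⟩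
  P ++ replicate d ℓ                                            ∎
  where open ≡-Reasoning

sum-replicate : ∀ k ℓ → sum (replicate k ℓ) ≡ k * ℓ
sum-replicate zero ℓ = refl
sum-replicate (suc k) ℓ = cong (ℓ +_) (sum-replicate k ℓ)

seed-split : ∀ {ℓ ν} → Seed ℓ ν →
             Σ (List ℕ) λ P → Σ ℕ λ c → ν ≡ P ++ replicate (suc c) ℓ × All (_< ℓ) P
seed-split {ν = x ∷ t} (_ , s , refl) = split-top (Contiguous⇒Sorted s)

mult-seed : ∀ {ℓ λ'} P m → Seed ℓ λ' → λ' ≡ P ++ replicate m ℓ → All (_< ℓ) P → mult λ' ≡ m
mult-seed {λ' = λ'} P m seed refl P<ℓ =
  trans (cong (λ v → count v λ') (maxPart-seed seed)) (count-top P m P<ℓ)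

mult-pad : ∀ {ℓ ν} k → Seed ℓ ν → suc k ≤ mult (ν ++ replicate k ℓ)
mult-pad {ℓ} {ν} k seed with seed-split seed
... | P , c , ν≡ , P<ℓ =
  subst (suc k ≤_) (sym (mult-seed P _ (seed-pad k seed) padded P<ℓ)) (s≤s (m≤n+m k c))
  where
  padded : ν ++ replicate k ℓ ≡ P ++ replicate (suc c + k) ℓ
  padded = trans (cong (_++ replicate k ℓ) ν≡) (++-replicate-+ P (suc c) k ℓ)

removeOne-pad : ∀ {ℓ ν} k → Seed ℓ ν → iterate (removeOne ℓ) k (ν ++ replicate k ℓ) ≡ ν
removeOne-pad {ℓ} {ν} k seed with seed-split seed
... | P , c , ν≡ , P<ℓ = begin
  iterate (removeOne ℓ) k (ν ++ replicate k ℓ)            ≡⟨ cong (iterate (removeOne ℓ) k) padded ⟩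
  iterate (removeOne ℓ) k (P ++ replicate (k + suc c) ℓ)  ≡⟨ removeOne-top-iterate P k (suc c) P<ℓ ⟩
  P ++ replicate (suc c) ℓ                                ≡⟨ ν≡ ⟨
  ν                                                       ∎
  where
  open ≡-Reasoning
  padded : ν ++ replicate k ℓ ≡ P ++ replicate (k + suc c) ℓ
  padded = trans (cong (_++ replicate k ℓ) ν≡)
                 (trans (++-replicate-+ P (suc c) k ℓ)
                        (cong (λ m → P ++ replicate m ℓ) (+-comm (suc c) k)))

seed-unpad : ∀ {ℓ λ' k} → Seed ℓ λ' → suc k ≤ mult λ' →
             Σ (List ℕ) λ ν → Seed ℓ ν × λ' ≡ ν ++ replicate k ℓ
seed-unpad {ℓ} {λ'} {k} seed k<mult with seed-split seed
... | P , c , λ'≡ , P<ℓ =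
  P ++ replicate (suc (c ∸ k)) ℓ , seed-resize P c (c ∸ k) (subst (Seed ℓ) λ'≡ seed) , λ'≡ν++
  where
  k≤c : k ≤ c
  k≤c = ≤-pred (subst (suc k ≤_) (mult-seed P (suc c) seed λ'≡ P<ℓ) k<mult)
  λ'≡ν++ : λ' ≡ (P ++ replicate (suc (c ∸ k)) ℓ) ++ replicate k ℓ
  λ'≡ν++ = trans λ'≡ (sym (trans (++-replicate-+ P (suc (c ∸ k)) k ℓ)
                                 (cong (λ m → P ++ replicate (suc m) ℓ) (m∸n+n≡m k≤c))))

ϱ-pad : ∀ {ℓ ν} k → 2 ≤ ℓ → Seed ℓ ν → ϱ (suc k) (ν ++ replicate k ℓ) ≡ iterate (rotate ℓ) k ν
ϱ-pad {ℓ} {ν} k 2≤ℓ seed = begin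
  ϱ (suc k) λ'
    ≡⟨ cong (λ m → iterate (ξ m) k (iterate (removeOne m) k λ')) (ℓ̄-seed (seed-pad k seed)) ⟩
  iterate (ξ ℓ) k (iterate (removeOne ℓ) k λ')  ≡⟨ cong (iterate (ξ ℓ) k) (removeOne-pad k seed) ⟩
  iterate (ξ ℓ) k ν                             ≡⟨ ξ-rotations 2≤ℓ (seed⇒window seed) k ⟩
  iterate (rotate ℓ) k ν                        ∎
  where
  open ≡-Reasoning
  λ' = ν ++ replicate k ℓ

ϱ-GI' : ∀ {n λ' k} → InGI' n λ' → suc k ≤ mult λ' →
        Σ (List ℕ) λ ν → Seed (ℓ̄ λ') ν × λ' ≡ ν ++ replicate k (ℓ̄ λ') ×
                         ϱ (suc k) λ' ≡ iterate (rotate (ℓ̄ λ')) k ν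
ϱ-GI' {k = k} g k<mult with seed-unpad (GI'⇒seed g) k<mult
... | ν , seed , λ'≡ =
  ν , seed , λ'≡ , trans (cong (ϱ (suc k)) λ'≡) (ϱ-pad k (proj₁ (GI'-width g)) seed)

sum-rotations-pad : ∀ {ℓ ν} → 2 ≤ ℓ → Seed ℓ ν → ∀ k →
                    sum (iterate (rotate ℓ) k ν) ≡ sum (ν ++ replicate k ℓ)
sum-rotations-pad {ℓ} {ν} 2≤ℓ seed k = begin
  sum (iterate (rotate ℓ) k ν)   ≡⟨ sum-rotations 2≤ℓ (seed⇒window seed) k ⟩
  sum ν + k * ℓ                  ≡⟨ cong (sum ν +_) (sum-replicate k ℓ) ⟨
  sum ν + sum (replicate k ℓ)    ≡⟨ sum-++ ν (replicate k ℓ) ⟨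
  sum (ν ++ replicate k ℓ)       ∎
  where open ≡-Reasoning

InUnion𝒢 : ℕ → List ℕ → Set
InUnion𝒢 n μ = Σ (List ℕ) (λ λ' → InGI' n λ' × Σ ℕ (λ i → 1 ≤ i × i ≤ mult λ' × μ ≡ ϱ i λ'))

rotation-of-seed∈⋃ : ∀ {n ℓ ν} k → EvenWidth ℓ → Seed ℓ ν →
                     sum (iterate (rotate ℓ) k ν) ≡ n → InUnion𝒢 n (iterate (rotate ℓ) k ν)
rotation-of-seed∈⋃ {ℓ = ℓ} {ν} k (2≤ℓ , 2∣ℓ) seed sum≡n =
  ν ++ replicate k ℓ ,
  seed⇒GI' (seed-pad k seed) 2∣ℓ (trans (sym (sum-rotations-pad 2≤ℓ seed k)) sum≡n) ,
  suc k , s≤s z≤n , mult-pad k seed , sym (ϱ-pad k 2≤ℓ seed)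

contiguous-window : ∀ {x t} → Contiguous (x ∷ t) → 1 ≤ x → ℓ̄ (x ∷ t) ≢ 1 →
                    Σ ℕ λ ℓ → EvenWidth ℓ × Window ℓ (x ∷ t)
contiguous-window {x} s 1≤x ℓ̄≢1 with distinct-contiguous s
... | zero , _ , distinct≡ = ⊥-elim (ℓ̄≢1 (cong length distinct≡))
... | suc w , last≡ , _ with ∃-even-Step (suc w)
...   | ℓ , 2∣ℓ , 1+w~ℓ =
  ℓ , (even⇒2≤ 2∣ℓ (≤-trans (s≤s z≤n) (Step⇒≤ 1+w~ℓ)) , 2∣ℓ) ,
  s , 1≤x , subst (λ b → Step b (x + ℓ)) (sym last≡) (Step-+ˡ x 1+w~ℓ)

G∖G0⊆⋃ : ∀ {n μ} → 1 ≤ n → InG n μ → ¬ InG0 n μ → InUnion𝒢 n μ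
G∖G0⊆⋃ {μ = []} 1≤n ((_ , _ , refl) , _) _ = ⊥-elim (<-irrefl refl 1≤n)
G∖G0⊆⋃ {n} {x ∷ t} _ (part@(sorted , 0<x ∷ _ , sum≡n) , gf) ¬G0
  with contiguous-window (GapFree⇒Contiguous sorted gf) 0<x (λ ℓ̄≡1 → ¬G0 (part , ℓ̄≡1))
... | ℓ , even@(2≤ℓ , _) , w with unrotate 2≤ℓ w
...   | ν , k , seed , μ≡ = subst (InUnion𝒢 n) (sym μ≡)
  (rotation-of-seed∈⋃ k even seed (trans (cong sum (sym μ≡)) sum≡n))

ϱ∈G∖G0 : ∀ {n λ' i} → InGI' n λ' → 1 ≤ i → i ≤ mult λ' →
         InG n (ϱ i λ') × ¬ InG0 n (ϱ i λ')
ϱ∈G∖G0 {n} {λ'} {suc k} g@(((_ , _ , sum≡n) , _) , _) _ i≤mult with ϱ-GI' g i≤mult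
... | ν , seed , λ'≡ , ϱ≡ =
  subst (λ μ → InG n μ × ¬ InG0 n μ) (sym ϱ≡)
    (window⇒G∖G0 2≤ℓ (rotations-window 2≤ℓ (seed⇒window seed) k)
                 (trans (sum-rotations-pad 2≤ℓ seed k) (trans (cong sum (sym λ'≡)) sum≡n)))
  where
  2≤ℓ = proj₁ (GI'-width g)

pad-determined-by-rotation : ∀ {ℓ₁ ℓ₂ ν₁ ν₂} k₁ k₂ → EvenWidth ℓ₁ → EvenWidth ℓ₂ →
  Seed ℓ₁ ν₁ → Seed ℓ₂ ν₂ → iterate (rotate ℓ₁) k₁ ν₁ ≡ iterate (rotate ℓ₂) k₂ ν₂ →
  ν₁ ++ replicate k₁ ℓ₁ ≡ ν₂ ++ replicate k₂ ℓ₂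
pad-determined-by-rotation k₁ k₂ (2≤ℓ₁ , 2∣ℓ₁) (2≤ℓ₂ , 2∣ℓ₂) s₁ s₂ eq
  with window-width-unique (rotations-window 2≤ℓ₁ (seed⇒window s₁) k₁)
         (subst (Window _) (sym eq) (rotations-window 2≤ℓ₂ (seed⇒window s₂) k₂)) 2∣ℓ₁ 2∣ℓ₂
... | refl with rotations-injective 2≤ℓ₁ s₁ s₂ k₁ k₂ eq
...   | refl , refl = refl

ϱ-injective : ∀ {n} λ₁ λ₂ → InGI' n λ₁ → InGI' n λ₂ → (i j : ℕ) → 1 ≤ i → i ≤ mult λ₁ →
              1 ≤ j → j ≤ mult λ₂ → ϱ i λ₁ ≡ ϱ j λ₂ → λ₁ ≡ λ₂
ϱ-injective λ₁ λ₂ g₁ g₂ (suc k₁) (suc k₂) _ i≤mult _ j≤mult eq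
  with ϱ-GI' g₁ i≤mult | ϱ-GI' g₂ j≤mult
... | ν₁ , s₁ , λ₁≡ , ϱ₁≡ | ν₂ , s₂ , λ₂≡ , ϱ₂≡ = begin
  λ₁                              ≡⟨ λ₁≡ ⟩
  ν₁ ++ replicate k₁ (ℓ̄ λ₁)       ≡⟨ pad-determined-by-rotation k₁ k₂ (GI'-width g₁) (GI'-width g₂)
                                      s₁ s₂ (trans (sym ϱ₁≡) (trans eq ϱ₂≡)) ⟩
  ν₂ ++ replicate k₂ (ℓ̄ λ₂)       ≡⟨ λ₂≡ ⟨
  λ₂                              ∎
  where open ≡-Reasoning

theorem5p4 : (n : ℕ) → 1 ≤ n →
    ((λ₁ λ₂ : List ℕ) → InGI' n λ₁ → InGI' n λ₂ →
      (i j : ℕ) → 1 ≤ i → i ≤ mult λ₁ → 1 ≤ j → j ≤ mult λ₂ →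
      ϱ i λ₁ ≡ ϱ j λ₂ → λ₁ ≡ λ₂)
    × ((μ : List ℕ) →
      (InG n μ × ¬ InG0 n μ) ⇔
      Σ (List ℕ) (λ λ' → InGI' n λ' × Σ ℕ (λ i → 1 ≤ i × i ≤ mult λ' × μ ≡ ϱ i λ')))
theorem5p4 n 1≤n = ϱ-injective , λ μ → mk⇔
  (λ (g , ¬G0) → G∖G0⊆⋃ 1≤n g ¬G0)
  (λ (λ' , g , i , 1≤i , i≤mult , μ≡) →
     subst (λ μ → InG n μ × ¬ InG0 n μ) (sym μ≡) (ϱ∈G∖G0 g 1≤i i≤mult))
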